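{- Let $G$ be a connected graph on $n$ vertices, and let $G^*$ be the graph constructed from $G$ as described in the context. If $G^*$ admits a locating $(n+3)$-coloring, then $G$ admits a proper $3$-coloring.
   Context: Construction of $G^*$: let $G$ have vertices $u_1,\dots,u_n$. Add new vertices $u'_1,\dots,u'_n$ and, for every edge $u_iu_j$ of $G$, add the edges $u'_iu'_j$, $u'_iu_j$ and $u_iu'_j$. For each $i\in\{1,\dots,n\}$ add a gadget $X_i$ consisting of a vertex $x_i$ and two independent sets $A_i=\{x_{i,1},\dots,x_{i,n-1}\}$ and $B_i=\{x'_{i,1},\dots,x'_{i,n+2}\}$, with $x_i$ adjacent to every vertex of $A_i\cup B_i$; also make $u_i$ and $u'_i$ adjacent to every vertex of $A_i$. Finally add an independent set $Y=\{y_1,y_2,y_3\}$ and make each $y_j$ adjacent to every vertex of $A_i$ and to $x_i$, for all $i$. There are no other edges. A proper $k$-coloring $f$ with color classes $S_1,\dots,S_k$ is a locating $k$-coloring if for any two distinct vertices $x,y$ there is $i$ with $d(x,S_i)\ne d(y,S_i)$, where $d(x,S)=\min_{z\in S} d(x,z)$ and $d$ is the shortest-path distance. -}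

module Defs where

open import Data.Nat using (ℕ; zero; suc; _+_; _∸_; _≤_)
open import Data.Fin using (Fin)
open import Data.Maybe using (Maybe; just; nothing)
open import Data.Product using (Σ; ∃; _×_; _,_)
open import Data.Unit using (⊤)
open import Data.Empty using (⊥)
open import Relation.Nullary using (¬_)
open import Relation.Binary.PropositionalEquality using (_≡_; _≢_)

record SimpleGraph (n : ℕ) : Set₁ where
  field
    Adj   : Fin n → Fin n → Set
    sym   : ∀ {i j} → Adj i j → Adj j i
    irrefl : ∀ {i} → ¬ Adj i i
open SimpleGraph public

data Walk {V : Set} (R : V → V → Set) : V → V → ℕ → Set where
  nil  : ∀ {x} → Walk R x x 0
  cons : ∀ {x y z k} → R x y → Walk R y z k → Walk R x z (suc k)

Connected : {V : Set} → (V → V → Set) → Set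
Connected {V} R = ∀ (x y : V) → ∃ λ k → Walk R x y k

-- Shortest-path distance from a vertex x to a vertex set S (given as a
-- predicate), with values in ℕ ∪ {∞}; ∞ is represented by nothing.
-- IsDist R x S d  means  d = d(x,S) = min_{z ∈ S} d(x,z).
IsDist : {V : Set} → (V → V → Set) → V → (V → Set) → Maybe ℕ → Set
IsDist {V} R x S (just d) =
  (Σ V λ z → S z × Walk R x z d) ×
  (∀ z m → S z → Walk R x z m → d ≤ m)
IsDist {V} R x S nothing = ∀ z m → S z → ¬ Walk R x z m

ProperColoring : {V : Set} → (V → V → Set) → (k : ℕ) → (V → Fin k) → Set
ProperColoring {V} R k c = ∀ (v w : V) → R v w → c v ≢ c w

LocatingColoring : {V : Set} → (V → V → Set) → (k : ℕ) → (V → Fin k) → Set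
LocatingColoring {V} R k c =
  ProperColoring R k c ×
  (∀ (v w : V) → v ≢ w →
     ∃ λ (i : Fin k) → ∃ λ (dv : Maybe ℕ) → ∃ λ (dw : Maybe ℕ) →
       IsDist R v (λ z → c z ≡ i) dv ×
       IsDist R w (λ z → c z ≡ i) dw × dv ≢ dw)

data VStar (n : ℕ) : Set where
  u  : Fin n → VStar n
  u' : Fin n → VStar n
  x  : Fin n → VStar n
  a  : Fin n → Fin (n ∸ 1) → VStar n    -- x_{i,j} ∈ A_i, j = 1..n-1
  b  : Fin n → Fin (n + 2) → VStar n    -- x'_{i,j} ∈ B_i, j = 1..n+2
  y  : Fin 3 → VStar n

AdjStar : ∀ {n} → SimpleGraph n → VStar n → VStar n → Set
AdjStar G (u i)  (u j)  = Adj G i j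
AdjStar G (u' i) (u' j) = Adj G i j
AdjStar G (u' i) (u j)  = Adj G i j
AdjStar G (u i)  (u' j) = Adj G i j
AdjStar G (u i)  (a j _) = i ≡ j
AdjStar G (a j _) (u i)  = i ≡ j
AdjStar G (u' i) (a j _) = i ≡ j
AdjStar G (a j _) (u' i) = i ≡ j
AdjStar G (x i) (a j _) = i ≡ j
AdjStar G (a j _) (x i) = i ≡ j
AdjStar G (x i) (b j _) = i ≡ j
AdjStar G (b j _) (x i) = i ≡ j
AdjStar G (y _) (a _ _) = ⊤
AdjStar G (a _ _) (y _) = ⊤
AdjStar G (y _) (x _)   = ⊤
AdjStar G (x _) (y _)   = ⊤
AdjStar G _ _ = ⊥

{-# OPTIONS --safe #-}

-- Vertices with the same open neighbourhood and the same colour are at the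
-- same distance from every colour class, so a locating colouring separates
-- such twins by colour. In G* the n + 3 vertices x_i, y_1, y_2, y_3 and A_i
-- are pairwise adjacent or twins, so they use all n + 3 colours; as u_i and
-- u'_i see all of A_i, each is coloured like x_i or like some y_k, and as
-- they are twins at most one of them is coloured like x_i. Giving vertex i
-- of G the index k of the colour of y_k carried by u_i or u'_i is a proper
-- 3-colouring, since for an edge ij of G each of u_i, u'_i is adjacent to
-- each of u_j, u'_j.
module Submission where

open import Defs hiding (sym)
open import Data.Bool using (Bool; true; false)
open import Data.Nat using (ℕ; zero; suc; _+_; _≤_)
open import Data.Nat.Properties using (≤-antisym; ≤-reflexive; +-comm; <-irrefl; ≤-trans)
open import Data.Fin using (Fin; zero; suc; splitAt; join)
open import Data.Fin.Properties using (_≟_; any?; injective⇒≤; join-splitAt)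
open import Data.Maybe using (just; nothing)
open import Data.Product using (∃; Σ; _,_; _×_; proj₁; proj₂)
open import Data.Sum using (_⊎_; inj₁; inj₂; [_,_]′)
open import Data.Empty using (⊥-elim)
open import Data.Unit using (tt)
open import Function using (_∘_; id)
open import Function.Definitions using (Injective)
open import Relation.Nullary using (yes; no)
open import Relation.Binary.PropositionalEquality

injective⇒surjective : ∀ {N K} (g : Fin N → Fin K) → Injective _≡_ _≡_ g → K ≤ N →
  ∀ κ → ∃ λ s → κ ≡ g s
injective⇒surjective {N} {K} g g-inj K≤N κ with any? (λ s → κ ≟ g s)
... | yes hit = hit
... | no miss = ⊥-elim (<-irrefl refl (≤-trans (injective⇒≤ g′-inj) K≤N))
  where
  g′ : Fin (suc N) → Fin K
  g′ zero    = κ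
  g′ (suc s) = g s

  g′-inj : Injective _≡_ _≡_ g′
  g′-inj {zero}  {zero}  _ = refl
  g′-inj {zero}  {suc t} e = ⊥-elim (miss (t , e))
  g′-inj {suc s} {zero}  e = ⊥-elim (miss (s , sym e))
  g′-inj {suc s} {suc t} e = cong suc (g-inj e)

Twins : {V : Set} → (V → V → Set) → V → V → Set₁
Twins R v w = ∀ t → R v t ≡ R w t

module _ {V : Set} (R : V → V → Set) {k : ℕ} (c : V → Fin k) where

  ColourClass : Fin k → V → Set
  ColourClass κ z = c z ≡ κ

  IsDist-unique : ∀ {v S d d′} → IsDist R v S d → IsDist R v S d′ → d ≡ d′
  IsDist-unique {d = just d}  {just d′} ((z , Sz , p) , min) ((z′ , Sz′ , p′) , min′) =
    cong just (≤-antisym (min z′ d′ Sz′ p′) (min′ z d Sz p))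
  IsDist-unique {d = just d}  {nothing} ((z , Sz , p) , _) none = ⊥-elim (none z d Sz p)
  IsDist-unique {d = nothing} {just d′} none ((z , Sz , p) , _) = ⊥-elim (none z d′ Sz p)
  IsDist-unique {d = nothing} {nothing} _ _ = refl

  twin-walk : ∀ {v w κ z m} → Twins R v w → c v ≡ c w → ColourClass κ z → Walk R v z m →
    ∃ λ z′ → ColourClass κ z′ × Walk R w z′ m
  twin-walk {w = w} _  cv≡cw cz nil        = w , trans (sym cv≡cw) cz , nil
  twin-walk {z = z} tw _     cz (cons r p) = z , cz , cons (subst id (tw _) r) p

  twin-IsDist : ∀ {v w κ} d → Twins R v w → c v ≡ c w →
    IsDist R v (ColourClass κ) d → IsDist R w (ColourClass κ) d
  twin-IsDist (just d) tw cv≡cw ((z , cz , p) , min) =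
    twin-walk tw cv≡cw cz p ,
    λ z′ m cz′ p′ → let (z″ , cz″ , p″) = twin-walk (sym ∘ tw) (sym cv≡cw) cz′ p′
                    in min z″ m cz″ p″
  twin-IsDist nothing tw cv≡cw none z′ m cz′ p′ =
    let (z″ , cz″ , p″) = twin-walk (sym ∘ tw) (sym cv≡cw) cz′ p′ in none z″ m cz″ p″

  locating⇒twins-coloured-apart : LocatingColoring R k c → ∀ {v w} → Twins R v w → v ≢ w →
    c v ≢ c w
  locating⇒twins-coloured-apart (_ , locate) {v} {w} tw v≢w cv≡cw
    with κ , dv , dw , v-dist , w-dist , dv≢dw ← locate v w v≢w =
    dv≢dw (IsDist-unique (twin-IsDist dv tw cv≡cw v-dist) w-dist)

  locating⇒twin-family-injective : LocatingColoring R k c → ∀ {m} (ι : Fin m → V) →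
    Injective _≡_ _≡_ ι → (∀ s t → Twins R (ι s) (ι t)) → Injective _≡_ _≡_ (c ∘ ι)
  locating⇒twin-family-injective L ι ι-inj twins {s} {t} e with s ≟ t
  ... | yes s≡t = s≡t
  ... | no  s≢t = ⊥-elim (locating⇒twins-coloured-apart L (twins s t) (s≢t ∘ ι-inj) e)

module LocatingColouringOfGStar {m : ℕ} (G : SimpleGraph (suc m))
  {c : VStar (suc m) → Fin (suc m + 3)} (L : LocatingColoring (AdjStar G) (suc m + 3) c) where

  proper : ∀ v w → AdjStar G v w → c v ≢ c w
  proper = proj₁ L

  y-twins : ∀ k k′ → Twins (AdjStar G) (y k) (y k′)
  y-twins k k′ (u _)   = refl
  y-twins k k′ (u' _)  = refl
  y-twins k k′ (x _)   = refl
  y-twins k k′ (a _ _) = refl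
  y-twins k k′ (b _ _) = refl
  y-twins k k′ (y _)   = refl

  a-twins : ∀ i j j′ → Twins (AdjStar G) (a i j) (a i j′)
  a-twins i j j′ (u _)   = refl
  a-twins i j j′ (u' _)  = refl
  a-twins i j j′ (x _)   = refl
  a-twins i j j′ (a _ _) = refl
  a-twins i j j′ (b _ _) = refl
  a-twins i j j′ (y _)   = refl

  u-twins : ∀ i → Twins (AdjStar G) (u i) (u' i)
  u-twins i (u _)   = refl
  u-twins i (u' _)  = refl
  u-twins i (x _)   = refl
  u-twins i (a _ _) = refl
  u-twins i (b _ _) = refl
  u-twins i (y _)   = refl

  y-colour-injective : Injective _≡_ _≡_ (c ∘ y)
  y-colour-injective = locating⇒twin-family-injective (AdjStar G) c L y (λ { refl → refl }) y-twins

  a-colour-injective : ∀ i → Injective _≡_ _≡_ (c ∘ a i)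
  a-colour-injective i =
    locating⇒twin-family-injective (AdjStar G) c L (a i) (λ { refl → refl }) (a-twins i)

  module Gadget (i : Fin (suc m)) where

    apex : Fin 4 → VStar (suc m)
    apex zero    = x i
    apex (suc k) = y k

    apex-adj-A : ∀ s j → AdjStar G (apex s) (a i j)
    apex-adj-A zero    j = refl
    apex-adj-A (suc k) j = tt

    apex-colour-injective : Injective _≡_ _≡_ (c ∘ apex)
    apex-colour-injective {zero}  {zero}   _ = refl
    apex-colour-injective {zero}  {suc k}  e = ⊥-elim (proper (x i) (y k) tt e)
    apex-colour-injective {suc k} {zero}   e = ⊥-elim (proper (y k) (x i) tt e)
    apex-colour-injective {suc k} {suc k′} e = cong suc (y-colour-injective e)

    member : Fin 4 ⊎ Fin m → VStar (suc m)
    member = [ apex , a i ]′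

    member-colour-injective : Injective _≡_ _≡_ (c ∘ member)
    member-colour-injective {inj₁ s} {inj₁ t}  e = cong inj₁ (apex-colour-injective e)
    member-colour-injective {inj₁ s} {inj₂ j}  e = ⊥-elim (proper _ _ (apex-adj-A s j) e)
    member-colour-injective {inj₂ j} {inj₁ s}  e = ⊥-elim (proper _ _ (apex-adj-A s j) (sym e))
    member-colour-injective {inj₂ j} {inj₂ j′} e = cong inj₂ (a-colour-injective i e)

    palette : Fin (4 + m) → VStar (suc m)
    palette = member ∘ splitAt 4

    palette-colour-injective : Injective _≡_ _≡_ (c ∘ palette)
    palette-colour-injective {s} {t} e = begin
      s                       ≡⟨ sym (join-splitAt 4 m s) ⟩
      join 4 m (splitAt 4 s)  ≡⟨ cong (join 4 m) (member-colour-injective {splitAt 4 s} {splitAt 4 t} e) ⟩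
      join 4 m (splitAt 4 t)  ≡⟨ join-splitAt 4 m t ⟩
      t                       ∎
      where open ≡-Reasoning

    apex-coloured : ∀ v → (∀ j → AdjStar G v (a i j)) → ∃ λ s → c v ≡ c (apex s)
    apex-coloured v v-adj-A
      with s , cv≡ ← injective⇒surjective (c ∘ palette) palette-colour-injective
                       (≤-reflexive (+-comm (suc m) 3)) (c v)
      with splitAt 4 s
    ... | inj₁ t = t , cv≡
    ... | inj₂ j = ⊥-elim (proper v (a i j) (v-adj-A j) cv≡)

  copy : Bool → Fin (suc m) → VStar (suc m)
  copy true  = u
  copy false = u'

  copies-adjacent : ∀ {i j} s t → Adj G i j → AdjStar G (copy s i) (copy t j)
  copies-adjacent true  true  r = r
  copies-adjacent true  false r = r
  copies-adjacent false true  r = r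
  copies-adjacent false false r = r

  y-coloured-copy : ∀ i → Σ Bool λ s → ∃ λ k → c (copy s i) ≡ c (y k)
  y-coloured-copy i
    with Gadget.apex-coloured i (u i) (λ _ → refl) | Gadget.apex-coloured i (u' i) (λ _ → refl)
  ... | suc k , e | _         = true , k , e
  ... | zero  , _ | suc k , e = false , k , e
  ... | zero  , e | zero , e′ =
    ⊥-elim (locating⇒twins-coloured-apart (AdjStar G) c L (u-twins i) (λ ()) (trans e (sym e′)))

  colouring : Fin (suc m) → Fin 3
  colouring i = proj₁ (proj₂ (y-coloured-copy i))

  colouring-proper : ProperColoring (Adj G) 3 colouring
  colouring-proper i j r k≡k′
    with s , k , cs ← y-coloured-copy i | t , k′ , ct ← y-coloured-copy j =
    proper (copy s i) (copy t j) (copies-adjacent s t r)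
      (trans cs (trans (cong (c ∘ y) k≡k′) (sym ct)))

lemma8 : (n : ℕ) (G : SimpleGraph n) → Connected (Adj G) →
    ∃ (λ (c : VStar n → Fin (n + 3)) → LocatingColoring (AdjStar G) (n + 3) c) →
    ∃ (λ (f : Fin n → Fin 3) → ProperColoring (Adj G) 3 f)
lemma8 zero    G _ _       = (λ ()) , λ ()
lemma8 (suc m) G _ (c , L) = colouring , colouring-proper
  where open LocatingColouringOfGStar G L
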